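{- Let $n\ge2$ and consider the symmetric group $\mathfrak S_n$ with generating set $\{(1\ i):2\le i\le n\}$. The number of fully commutative elements is $1+\sum_{t=1}^{n-1}\prod_{j=1}^{t}(n-j)$. Moreover, for each $t>0$, the fully commutative elements of length $t$ are exactly the $(t+1)$-cycles that move $1$.
   Context: Length of $\pi\in\mathfrak S_n$ is the minimal number of generators (star transpositions $(1\ i)$) needed to write $\pi$; a reduced expression is a word of that minimal length. An element is fully commutative if any two reduced expressions of it are related by a sequence of interchanges of adjacent letters that commute as group elements. -}

module Defs where

open import Data.Nat using (ℕ; zero; suc; _+_; _∸_; _≤_)
open import Data.Fin using (Fin; zero; suc; inject₁; fromℕ)
open import Data.Fin.Permutation using (Permutation′; _⟨$⟩ʳ_; _∘ₚ_; transpose; id; _≈_)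
open import Data.List using (List; []; _∷_; _++_; length; map; upTo)
open import Data.Nat.ListAction using (sum; product)
open import Data.List.Relation.Unary.Any using (Any)
open import Data.List.Relation.Unary.All using (All)
open import Data.List.Relation.Unary.AllPairs using (AllPairs)
open import Data.Product using (Σ; ∃; _×_; _,_)
open import Function.Definitions using (Injective)
open import Relation.Binary.PropositionalEquality using (_≡_)
open import Relation.Binary.Construct.Closure.ReflexiveTransitive using (Star)
open import Relation.Nullary using (¬_)

-- Convention: n = suc m, points of {1,…,n} are Fin (suc m) with point 1 = zero.
-- Generators of 𝔖_n are the star transpositions (1 i), 2 ≤ i ≤ n,
-- indexed by k : Fin m, giving (zero  suc k).

Word : ℕ → Set
Word m = List (Fin m)

star : ∀ {m} → Fin m → Permutation′ (suc m)
star k = transpose zero (suc k)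

eval : ∀ {m} → Word m → Permutation′ (suc m)
eval []      = id
eval (k ∷ w) = star k ∘ₚ eval w

Expresses : ∀ {m} → Word m → Permutation′ (suc m) → Set
Expresses w π = eval w ≈ π

Reduced : ∀ {m} → Word m → Permutation′ (suc m) → Set
Reduced {m} w π = Expresses w π × (∀ (w′ : Word m) → Expresses w′ π → length w ≤ length w′)

HasLength : ∀ {m} → Permutation′ (suc m) → ℕ → Set
HasLength π t = Σ _ λ w → Reduced w π × length w ≡ t

data CommStep {m : ℕ} : Word m → Word m → Set where
  swap : ∀ (u v : Word m) (a b : Fin m) →
         (star a ∘ₚ star b) ≈ (star b ∘ₚ star a) →
         CommStep (u ++ (a ∷ b ∷ v)) (u ++ (b ∷ a ∷ v))

CommEquiv : ∀ {m} → Word m → Word m → Set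
CommEquiv = Star CommStep

FullyCommutative : ∀ {m} → Permutation′ (suc m) → Set
FullyCommutative {m} π =
  ∀ (w w′ : Word m) → Reduced w π → Reduced w′ π → CommEquiv w w′

-- π is a (k+1)-cycle  (c 0 ↦ c 1 ↦ … ↦ c k ↦ c 0), fixing all other points
IsCycle : ∀ {n} (k : ℕ) → Permutation′ n → Set
IsCycle {n} k π =
  Σ (Fin (suc k) → Fin n) λ c →
    Injective _≡_ _≡_ c
    × (∀ (i : Fin k) → π ⟨$⟩ʳ (c (inject₁ i)) ≡ c (suc i))
    × (π ⟨$⟩ʳ (c (fromℕ k)) ≡ c zero)
    × (∀ (x : Fin n) → (∀ (i : Fin (suc k)) → ¬ (c i ≡ x)) → π ⟨$⟩ʳ x ≡ x)

Moves1 : ∀ {m} → Permutation′ (suc m) → Set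
Moves1 π = ¬ (π ⟨$⟩ʳ zero ≡ zero)

from1 : ℕ → List ℕ
from1 k = map suc (upTo k)

fcCount : ℕ → ℕ
fcCount n = 1 + sum (map (λ t → product (map (λ j → n ∸ j) (from1 t))) (from1 (n ∸ 1)))

CountFC : ℕ → ℕ → Set
CountFC m N =
  Σ (List (Permutation′ (suc m))) λ L →
    All FullyCommutative L
    × (∀ π → FullyCommutative π → Any (λ ρ → ρ ≈ π) L)
    × AllPairs (λ ρ σ → ¬ (ρ ≈ σ)) L
    × length L ≡ N

{-# OPTIONS --safe #-}
-- Two star transpositions commute only when they are equal, so a permutation is fully
-- commutative exactly when it has a single reduced word.  (Points are Fin (suc m), with 0
-- playing the paper's 1, and words act letter by letter from the left.)  A word k₁ ⋯ kₜ
-- with distinct letters acts as the (t+1)-cycle 0 ↦ k₁+1 ↦ ⋯ ↦ kₜ+1 ↦ 0.  Every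
-- expression of that cycle must contain each kᵢ, as kᵢ+1 is moved, so distinct-letter
-- words are reduced and are the only reduced words of their value.  Conversely, in the
-- innermost repetition a v a of a reduced word, v is not empty (a a would cancel), and
-- a x v′ a may be replaced by x v′ a x, giving a second reduced word.  Hence the fully
-- commutative elements are the values of distinct-letter words, i.e. the cycles through 0,
-- and choosing the letters one at a time counts them: 1 + Σₜ (n-1)(n-2)⋯(n-t).
module Submission where

open import Defs
open import Data.Fin using (Fin; zero; suc; inject₁; fromℕ; punchIn; punchOut)
open import Data.Fin.Induction using (<-weakInduction)
open import Data.Fin.Permutation using (Permutation′; _⟨$⟩ʳ_; _∘ₚ_; transpose; _≈_)
open import Data.Fin.Permutation as Perm using ()
open import Data.Fin.Permutation.Transposition.List as TL using (TranspositionList)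
open import Data.Fin.Properties
  using (_≟_; suc-injective; any?; all?; injective⇒≤; punchIn-punchOut; punchIn-injective; punchInᵢ≢i)
open import Data.List using (List; []; _∷_; _++_; length; map; lookup; tabulate; allFin; cartesianProductWith)
open import Data.List.Membership.Propositional using (_∈_; _∉_)
open import Data.List.Membership.Propositional.Properties
  using (∈-tabulate⁻; ∈-lookup; ∈-++⁺ˡ; ∈-++⁺ʳ; ∈-++⁻; ∈-allFin; ∈-cartesianProductWith⁺; ∈-cartesianProductWith⁻)
open import Data.List.Membership.Setoid.Properties using (index-injective)
open import Data.List.Properties
  using (length-++; length-map; length-tabulate; ++-assoc; ++-cancelˡ; ∷-injectiveˡ; ∷-injectiveʳ;
         tabulate-lookup; map-∘; map-cong; map-upTo; map-injective)
open import Data.List.Relation.Unary.All using (All; []; _∷_)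
import Data.List.Relation.Unary.All as All
open import Data.List.Relation.Unary.All.Properties using (All¬⇒¬Any; ¬Any⇒All¬; ++⁻ˡ)
import Data.List.Relation.Unary.All.Properties as All
open import Data.List.Relation.Unary.AllPairs as AllPairs using (AllPairs)
import Data.List.Relation.Unary.AllPairs.Properties as AllPairs
open import Data.List.Relation.Unary.Any as Any using (Any; here; there; index)
open import Data.List.Relation.Unary.Any.Properties using (lookup-index)
import Data.List.Relation.Unary.Any.Properties as Any
open import Data.List.Relation.Unary.Unique.Propositional as Unique using (Unique; []; _∷_)
open import Data.List.Relation.Unary.Unique.Propositional.Properties
  using (Unique[x∷xs]⇒x∉xs; tabulate⁺; allFin⁺)
import Data.List.Relation.Unary.Unique.Propositional.Properties as Unique
open import Data.Nat using (ℕ; zero; suc; _+_; _*_; _∸_; _≤_; _<_; z≤n; s≤s)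
open import Data.Nat.ListAction using (sum; product)
open import Data.Nat.Properties using (*-zeroʳ; *-distribˡ-+; +-suc; +-monoʳ-<; <⇒≱; ≤-<-trans; n<1+n; n≤1+n)
open import Data.Product using (∃; ∃₂; _×_; _,_; proj₁)
open import Data.Sum using (_⊎_; inj₁; inj₂)
open import Function using (id; _∘_; case_of_; Injective; Injection)
open import Function.Bundles using (_⇔_; mk⇔)
open import Function.Properties.Inverse using (↔⇒↣)
open import Relation.Binary.Construct.Closure.ReflexiveTransitive using (ε; _◅_)
open import Relation.Binary.Definitions using (DecidableEquality)
open import Relation.Binary.PropositionalEquality
open import Relation.Nullary using (¬_; Dec; yes; no; contradiction)
open import Relation.Nullary.Decidable using (dec-true; dec-false; decidable-stable)

module _ {A : Set} where

  lookup-injective : ∀ {xs : List A} → Unique xs → Injective _≡_ _≡_ (lookup xs)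
  lookup-injective {x ∷ xs} _         {zero}  {zero}  _  = refl
  lookup-injective {x ∷ xs} (x∉ ∷ _)  {zero}  {suc j} eq =
    contradiction (subst (_∈ xs) (sym eq) (∈-lookup j)) (All¬⇒¬Any x∉)
  lookup-injective {x ∷ xs} (x∉ ∷ _)  {suc i} {zero}  eq =
    contradiction (subst (_∈ xs) eq (∈-lookup i)) (All¬⇒¬Any x∉)
  lookup-injective {x ∷ xs} (_ ∷ xs!) {suc i} {suc j} eq = cong suc (lookup-injective xs! eq)

  unique-⊆⇒length-≤ : ∀ {xs ys : List A} → Unique xs → (∀ {x} → x ∈ xs → x ∈ ys) → length xs ≤ length ys
  unique-⊆⇒length-≤ xs! xs⊆ys = injective⇒≤ λ {i} {j} eq →
    lookup-injective xs! (index-injective (setoid A) (xs⊆ys (∈-lookup i)) (xs⊆ys (∈-lookup j)) eq)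

  drop-later-copy : ∀ {a y : A} xs {ys} → a ∈ xs → y ∈ xs ++ a ∷ ys → y ∈ xs ++ ys
  drop-later-copy xs a∈xs y∈ with ∈-++⁻ xs y∈
  ... | inj₁ y∈xs         = ∈-++⁺ˡ y∈xs
  ... | inj₂ (here refl)  = ∈-++⁺ˡ a∈xs
  ... | inj₂ (there y∈ys) = ∈-++⁺ʳ xs y∈ys

  ++-length-<ʳ : ∀ (u : List A) {v v′} → length v < length v′ → length (u ++ v) < length (u ++ v′)
  ++-length-<ʳ u v<v′ = subst₂ _<_ (sym (length-++ u)) (sym (length-++ u)) (+-monoʳ-< (length u) v<v′)

  ++-length-congʳ : ∀ (u : List A) {v v′} → length v ≡ length v′ → length (u ++ v) ≡ length (u ++ v′)
  ++-length-congʳ u v≡v′ = trans (length-++ u) (trans (cong (length u +_) v≡v′) (sym (length-++ u)))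

data Repeat {A : Set} : List A → Set where
  repeat : ∀ p a v s → Unique (a ∷ v) → Repeat (p ++ a ∷ v ++ a ∷ s)

module _ {A : Set} where

  split-unique : ∀ {a : A} {r} → Unique r → a ∈ r → ∃₂ λ v s → r ≡ v ++ a ∷ s × Unique (a ∷ v)
  split-unique {r = a ∷ r} _ (here refl) = [] , r , refl , [] ∷ []
  split-unique {a = a} {j ∷ r} (j∉r ∷ r!) (there a∈r) with split-unique r! a∈r
  ... | v , s , refl , (a∉v ∷ v!) = j ∷ v , s , refl , (a≢j ∷ a∉v) ∷ (++⁻ˡ v j∉r ∷ v!)
    where
    a≢j : a ≢ j
    a≢j refl = All¬⇒¬Any j∉r a∈r

  unique⊎repeat : DecidableEquality A → ∀ (w : List A) → Unique w ⊎ Repeat w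
  unique⊎repeat _   []      = inj₁ []
  unique⊎repeat eq? (k ∷ r) with unique⊎repeat eq? r
  ... | inj₂ (repeat p a v s a∷v!) = inj₂ (repeat (k ∷ p) a v s a∷v!)
  ... | inj₁ r! with Any.any? (eq? k) r
  ...   | no k∉r  = inj₁ (¬Any⇒All¬ r k∉r ∷ r!)
  ...   | yes k∈r with split-unique r! k∈r
  ...     | v , s , refl , k∷v! = inj₂ (repeat [] k v s k∷v!)

AllPairs-map-All : ∀ {A : Set} {P : A → Set} {R S : A → A → Set} →
                   (∀ {x y} → P x → P y → R x y → S x y) →
                   ∀ {xs} → All P xs → AllPairs R xs → AllPairs S xs
AllPairs-map-All f []         AllPairs.[]          = AllPairs.[]
AllPairs-map-All f (px ∷ pxs) (rx AllPairs.∷ rxs) =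
  All.zipWith (λ (py , rxy) → f px py rxy) (pxs , rx) AllPairs.∷ AllPairs-map-All f pxs rxs

length-cartesianProductWith : ∀ {A B C : Set} (f : A → B → C) xs ys →
                              length (cartesianProductWith f xs ys) ≡ length xs * length ys
length-cartesianProductWith f []       ys = refl
length-cartesianProductWith f (x ∷ xs) ys =
  trans (length-++ (map (f x) ys)) (cong₂ _+_ (length-map (f x) ys) (length-cartesianProductWith f xs ys))

-- Star transpositions and words

transpose-matchˡ : ∀ {n} (i j : Fin n) → transpose i j ⟨$⟩ʳ i ≡ j
transpose-matchˡ i j rewrite dec-true (i ≟ i) refl = refl

transpose-matchʳ : ∀ {n} (i j : Fin n) → transpose i j ⟨$⟩ʳ j ≡ i
transpose-matchʳ i j with j ≟ i
... | yes refl = refl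
... | no _ rewrite dec-true (j ≟ j) refl = refl

transpose-fix : ∀ {n} {i j k : Fin n} → k ≢ i → k ≢ j → transpose i j ⟨$⟩ʳ k ≡ k
transpose-fix {i = i} {j} {k} k≢i k≢j rewrite dec-false (k ≟ i) k≢i | dec-false (k ≟ j) k≢j = refl

transpose-≈ : ∀ {n} {i j : Fin n} (π : Permutation′ n) →
              π ⟨$⟩ʳ i ≡ j → π ⟨$⟩ʳ j ≡ i → (∀ {k} → k ≢ i → k ≢ j → π ⟨$⟩ʳ k ≡ k) →
              transpose i j ≈ π
transpose-≈ {i = i} {j} π πi πj πk k = by-cases (k ≟ i) (k ≟ j)
  where
  -- Split on a Dec argument: a with on k ≟ i would also abstract the test inside transpose.
  by-cases : Dec (k ≡ i) → Dec (k ≡ j) → transpose i j ⟨$⟩ʳ k ≡ π ⟨$⟩ʳ k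
  by-cases (yes refl) _          = trans (transpose-matchˡ i j) (sym πi)
  by-cases (no _)     (yes refl) = trans (transpose-matchʳ i j) (sym πj)
  by-cases (no k≢i)   (no k≢j)   = trans (transpose-fix k≢i k≢j) (sym (πk k≢i k≢j))

transpose-refl : ∀ {n} (i : Fin n) → transpose i i ≈ Perm.id
transpose-refl i = transpose-≈ Perm.id refl refl λ _ _ → refl

permute-injective : ∀ {n} (π : Permutation′ n) → Injective _≡_ _≡_ (π ⟨$⟩ʳ_)
permute-injective π = Injection.injective (↔⇒↣ π)

star-suc-self : ∀ {m} (k : Fin m) → star k ⟨$⟩ʳ suc k ≡ zero
star-suc-self k = transpose-matchʳ zero (suc k)

star-fix : ∀ {m} {k : Fin m} {x} → x ≢ zero → x ≢ suc k → star k ⟨$⟩ʳ x ≡ x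
star-fix = transpose-fix

star-suc-≢ : ∀ {m} {j k : Fin m} → j ≢ k → star k ⟨$⟩ʳ suc j ≡ suc j
star-suc-≢ j≢k = star-fix (λ ()) (j≢k ∘ suc-injective)

star-involutive : ∀ {m} (k : Fin m) x → star k ⟨$⟩ʳ (star k ⟨$⟩ʳ x) ≡ x
star-involutive k zero    = star-suc-self k
star-involutive k (suc j) = by-cases (j ≟ k)
  where
  by-cases : Dec (j ≡ k) → star k ⟨$⟩ʳ (star k ⟨$⟩ʳ suc j) ≡ suc j
  by-cases (yes refl) = cong (star k ⟨$⟩ʳ_) (star-suc-self k)
  by-cases (no j≢k)   = trans (cong (star k ⟨$⟩ʳ_) (star-suc-≢ j≢k)) (star-suc-≢ j≢k)

star-star-fix : ∀ {m} {a x : Fin m} {z} → a ≢ x → z ≢ suc a → z ≢ suc x →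
                star x ⟨$⟩ʳ (star a ⟨$⟩ʳ z) ≡ star a ⟨$⟩ʳ z
star-star-fix {z = zero}  a≢x _   _   = star-suc-≢ a≢x
star-star-fix {a = a} {x} {suc k} _ z≢a z≢x =
  trans (cong (star x ⟨$⟩ʳ_) (star-fix (λ ()) z≢a)) (trans (star-fix (λ ()) z≢x) (sym (star-fix (λ ()) z≢a)))

commuting-stars-equal : ∀ {m} {a b : Fin m} → star a ∘ₚ star b ≈ star b ∘ₚ star a → a ≡ b
commuting-stars-equal {a = a} {b} commute with a ≟ b
... | yes a≡b = a≡b
... | no a≢b  = suc-injective (begin
  suc a             ≡⟨ star-suc-≢ a≢b ⟨
  star b ⟨$⟩ʳ suc a ≡⟨ commute zero ⟩
  star a ⟨$⟩ʳ suc b ≡⟨ star-suc-≢ (a≢b ∘ sym) ⟩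
  suc b             ∎)
  where open ≡-Reasoning

commStep⇒≡ : ∀ {m} {w w′ : Word m} → CommStep w w′ → w ≡ w′
commStep⇒≡ (swap u v a b commute) with refl ← commuting-stars-equal commute = refl

commEquiv⇒≡ : ∀ {m} {w w′ : Word m} → CommEquiv w w′ → w ≡ w′
commEquiv⇒≡ ε              = refl
commEquiv⇒≡ (step ◅ steps) = trans (commStep⇒≡ step) (commEquiv⇒≡ steps)

eval-++ : ∀ {m} (u v : Word m) → eval (u ++ v) ≈ eval u ∘ₚ eval v
eval-++ []      v x = refl
eval-++ (k ∷ u) v x = eval-++ u v (star k ⟨$⟩ʳ x)

eval-++-congʳ : ∀ {m} (u : Word m) {v v′} → eval v ≈ eval v′ → eval (u ++ v) ≈ eval (u ++ v′)
eval-++-congʳ u {v} {v′} v≈v′ x = begin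
  eval (u ++ v) ⟨$⟩ʳ x         ≡⟨ eval-++ u v x ⟩
  eval v ⟨$⟩ʳ (eval u ⟨$⟩ʳ x)  ≡⟨ v≈v′ _ ⟩
  eval v′ ⟨$⟩ʳ (eval u ⟨$⟩ʳ x) ≡⟨ eval-++ u v′ x ⟨
  eval (u ++ v′) ⟨$⟩ʳ x        ∎
  where open ≡-Reasoning

eval-∷-cancel : ∀ {m} {k : Fin m} {w w′} → eval (k ∷ w) ≈ eval (k ∷ w′) → eval w ≈ eval w′
eval-∷-cancel {k = k} {w} {w′} kw≈kw′ x = begin
  eval w ⟨$⟩ʳ x                      ≡⟨ cong (eval w ⟨$⟩ʳ_) (star-involutive k x) ⟨
  eval (k ∷ w) ⟨$⟩ʳ (star k ⟨$⟩ʳ x)  ≡⟨ kw≈kw′ (star k ⟨$⟩ʳ x) ⟩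
  eval (k ∷ w′) ⟨$⟩ʳ (star k ⟨$⟩ʳ x) ≡⟨ cong (eval w′ ⟨$⟩ʳ_) (star-involutive k x) ⟩
  eval w′ ⟨$⟩ʳ x                     ∎
  where open ≡-Reasoning

eval-fix-∉ : ∀ {m} {k : Fin m} {w} → k ∉ w → eval w ⟨$⟩ʳ suc k ≡ suc k
eval-fix-∉ {w = []}    _   = refl
eval-fix-∉ {w = j ∷ w} k∉w =
  trans (cong (eval w ⟨$⟩ʳ_) (star-suc-≢ (k∉w ∘ here))) (eval-fix-∉ (k∉w ∘ there))

module _ {m : ℕ} {π : Permutation′ (suc m)} (u v v′ : Word m) (v≈v′ : eval v ≈ eval v′) where

  reduced-replace : Reduced (u ++ v) π → length v ≡ length v′ → Reduced (u ++ v′) π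
  reduced-replace (uv↦π , minimal) v≡v′ =
    (λ x → trans (sym (eval-++-congʳ u v≈v′ x)) (uv↦π x)) ,
    λ w w↦π → subst (_≤ length w) (++-length-congʳ u v≡v′) (minimal w w↦π)

  reduced-no-shorter-replacement : Reduced (u ++ v) π → ¬ length v′ < length v
  reduced-no-shorter-replacement (uv↦π , minimal) v′<v =
    <⇒≱ (++-length-<ʳ u v′<v) (minimal (u ++ v′) λ x → trans (sym (eval-++-congʳ u v≈v′ x)) (uv↦π x))

-- Cycles

record IsCycleAlong {n t} (c : Fin (suc t) → Fin n) (π : Permutation′ n) : Set where
  field
    injective : Injective _≡_ _≡_ c
    step      : ∀ (i : Fin t) → π ⟨$⟩ʳ c (inject₁ i) ≡ c (suc i)
    wrap      : π ⟨$⟩ʳ c (fromℕ t) ≡ c zero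
    fix       : ∀ x → (∀ i → c i ≢ x) → π ⟨$⟩ʳ x ≡ x

isCycle : ∀ {n t} {c : Fin (suc t) → Fin n} {π} → IsCycleAlong c π → IsCycle t π
isCycle {c = c} cyc = c , injective , step , wrap , fix
  where open IsCycleAlong cyc

cycleAlong : ∀ {n t} {π : Permutation′ n} → IsCycle t π → ∃ λ c → IsCycleAlong c π
cycleAlong (c , c-inj , c-step , c-wrap , c-fix) =
  c , record { injective = c-inj ; step = c-step ; wrap = c-wrap ; fix = c-fix }

last-or-inject₁ : ∀ {t} (i : Fin (suc t)) → i ≡ fromℕ t ⊎ ∃ λ j → i ≡ inject₁ j
last-or-inject₁ {zero}  zero    = inj₁ refl
last-or-inject₁ {suc t} zero    = inj₂ (zero , refl)
last-or-inject₁ {suc t} (suc i) with last-or-inject₁ i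
... | inj₁ refl       = inj₁ refl
... | inj₂ (j , refl) = inj₂ (suc j , refl)

inject₁≢suc : ∀ {t} (j : Fin t) → inject₁ j ≢ suc j
inject₁≢suc zero    ()
inject₁≢suc (suc j) eq = inject₁≢suc j (suc-injective eq)

module _ {n t : ℕ} {c : Fin (suc t) → Fin n} {π : Permutation′ n} (cyc : IsCycleAlong c π) where
  open IsCycleAlong cyc

  cycle-resp-≈ : ∀ {ρ} → π ≈ ρ → IsCycleAlong c ρ
  cycle-resp-≈ π≈ρ = record
    { injective = injective
    ; step      = λ i → trans (sym (π≈ρ _)) (step i)
    ; wrap      = trans (sym (π≈ρ _)) wrap
    ; fix       = λ x x∉c → trans (sym (π≈ρ x)) (fix x x∉c)
    }

  cycle-unique : ∀ {c′ ρ} → IsCycleAlong c′ ρ → (∀ i → c i ≡ c′ i) → π ≈ ρ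
  cycle-unique {c′} {ρ} cyc′ c≗c′ x = by-cases (any? λ i → c i ≟ x)
    where
    module C′ = IsCycleAlong cyc′
    open ≡-Reasoning

    on-cycle : ∀ i → π ⟨$⟩ʳ c i ≡ ρ ⟨$⟩ʳ c i
    on-cycle i with last-or-inject₁ i
    ... | inj₁ refl = begin
      π ⟨$⟩ʳ c (fromℕ t)  ≡⟨ wrap ⟩
      c zero              ≡⟨ c≗c′ zero ⟩
      c′ zero             ≡⟨ C′.wrap ⟨
      ρ ⟨$⟩ʳ c′ (fromℕ t) ≡⟨ cong (ρ ⟨$⟩ʳ_) (c≗c′ (fromℕ t)) ⟨
      ρ ⟨$⟩ʳ c (fromℕ t)  ∎
    ... | inj₂ (j , refl) = begin
      π ⟨$⟩ʳ c (inject₁ j)  ≡⟨ step j ⟩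
      c (suc j)             ≡⟨ c≗c′ (suc j) ⟩
      c′ (suc j)            ≡⟨ C′.step j ⟨
      ρ ⟨$⟩ʳ c′ (inject₁ j) ≡⟨ cong (ρ ⟨$⟩ʳ_) (c≗c′ (inject₁ j)) ⟨
      ρ ⟨$⟩ʳ c (inject₁ j)  ∎

    by-cases : Dec (∃ λ i → c i ≡ x) → π ⟨$⟩ʳ x ≡ ρ ⟨$⟩ʳ x
    by-cases (yes (i , ci≡x)) = subst (λ y → π ⟨$⟩ʳ y ≡ ρ ⟨$⟩ʳ y) ci≡x (on-cycle i)
    by-cases (no x∉c)         =
      trans (fix x λ i → x∉c ∘ (i ,_)) (sym (C′.fix x λ i c′i≡x → x∉c (i , trans (c≗c′ i) c′i≡x)))

  cycle-rotate : IsCycleAlong (λ i → π ⟨$⟩ʳ c i) π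
  cycle-rotate = record
    { injective = injective ∘ permute-injective π
    ; step      = cong (π ⟨$⟩ʳ_) ∘ step
    ; wrap      = cong (π ⟨$⟩ʳ_) wrap
    ; fix       = λ x x∉πc → fix x λ where
        zero    c0≡x → x∉πc (fromℕ t) (trans wrap c0≡x)
        (suc i) ci≡x → x∉πc (inject₁ i) (trans (step i) ci≡x)
    }

cycle-startingAt : ∀ {n t} {c : Fin (suc t) → Fin n} {π} → IsCycleAlong c π →
                   ∀ i → ∃ λ (c′ : Fin (suc t) → Fin n) → IsCycleAlong c′ π × c′ zero ≡ c i
cycle-startingAt {n} {t} {c} {π} cyc =
  <-weakInduction (λ i → ∃ λ (c′ : Fin (suc t) → Fin n) → IsCycleAlong c′ π × c′ zero ≡ c i) (c , cyc , refl)
    λ j (_ , cyc′ , c′0≡cj) → _ , cycle-rotate cyc′ , trans (cong (π ⟨$⟩ʳ_) c′0≡cj) (IsCycleAlong.step cyc j)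

cycle-moves : ∀ {n t} {c : Fin (suc (suc t)) → Fin n} {π} → IsCycleAlong c π → ∀ i → π ⟨$⟩ʳ c i ≢ c i
cycle-moves cyc i with last-or-inject₁ i
... | inj₁ refl       = λ moved → case injective (trans (sym wrap) moved) of λ ()
  where open IsCycleAlong cyc
... | inj₂ (j , refl) = λ moved → inject₁≢suc j (injective (trans (sym moved) (step j)))
  where open IsCycleAlong cyc

-- Distinct-letter words

starCycle : ∀ {m t} → (Fin t → Fin m) → Fin (suc t) → Fin (suc m)
starCycle f zero    = zero
starCycle f (suc i) = suc (f i)

module _ {m : ℕ} where

  head∉tabulate-tail : ∀ {t} {f : Fin (suc t) → Fin m} → Injective _≡_ _≡_ f → f zero ∉ tabulate (f ∘ suc)
  head∉tabulate-tail f-inj f0∈ with i , f0≡fi ← ∈-tabulate⁻ f0∈ = case f-inj f0≡fi of λ ()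

  star-head-fix-tail : ∀ {t} {f : Fin (suc t) → Fin m} → Injective _≡_ _≡_ f →
                       ∀ i → star (f zero) ⟨$⟩ʳ suc (f (suc i)) ≡ suc (f (suc i))
  star-head-fix-tail f-inj i = star-suc-≢ λ fi≡f0 → case f-inj fi≡f0 of λ ()

  tabulate-step : ∀ {t} {f : Fin t → Fin m} → Injective _≡_ _≡_ f →
                  ∀ i → eval (tabulate f) ⟨$⟩ʳ starCycle f (inject₁ i) ≡ suc (f i)
  tabulate-step f-inj zero = eval-fix-∉ (head∉tabulate-tail f-inj)
  tabulate-step {f = f} f-inj (suc zero) =
    trans (cong (eval (tabulate (f ∘ suc)) ⟨$⟩ʳ_) (star-suc-self (f zero)))
          (tabulate-step (suc-injective ∘ f-inj) zero)
  tabulate-step {f = f} f-inj (suc (suc i)) =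
    trans (cong (eval (tabulate (f ∘ suc)) ⟨$⟩ʳ_) (star-head-fix-tail f-inj (inject₁ i)))
          (tabulate-step (suc-injective ∘ f-inj) (suc i))

  tabulate-wrap : ∀ {t} {f : Fin t → Fin m} → Injective _≡_ _≡_ f →
                  eval (tabulate f) ⟨$⟩ʳ starCycle f (fromℕ t) ≡ zero
  tabulate-wrap {zero}              f-inj = refl
  tabulate-wrap {suc zero}    {f}   f-inj = star-suc-self (f zero)
  tabulate-wrap {suc (suc t)} {f}   f-inj =
    trans (cong (eval (tabulate (f ∘ suc)) ⟨$⟩ʳ_) (star-head-fix-tail f-inj (fromℕ t)))
          (tabulate-wrap (suc-injective ∘ f-inj))

  tabulate-isCycle : ∀ {t} {f : Fin t → Fin m} → Injective _≡_ _≡_ f →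
                     IsCycleAlong (starCycle f) (eval (tabulate f))
  tabulate-isCycle {f = f} f-inj = record
    { injective = starCycle-injective
    ; step      = tabulate-step f-inj
    ; wrap      = tabulate-wrap f-inj
    ; fix       = fixes
    }
    where
    starCycle-injective : Injective _≡_ _≡_ (starCycle f)
    starCycle-injective {zero}  {zero}  _  = refl
    starCycle-injective {suc i} {suc j} eq = cong suc (f-inj (suc-injective eq))

    fixes : ∀ x → (∀ i → starCycle f i ≢ x) → eval (tabulate f) ⟨$⟩ʳ x ≡ x
    fixes zero    x∉c = contradiction refl (x∉c zero)
    fixes (suc k) x∉c = eval-fix-∉ λ k∈ → let i , k≡fi = ∈-tabulate⁻ k∈ in x∉c (suc i) (cong suc (sym k≡fi))

  unique-isCycle : ∀ {w : Word m} → Unique w → IsCycleAlong (starCycle (lookup w)) (eval w)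
  unique-isCycle {w} w! = cycle-resp-≈ (tabulate-isCycle (lookup-injective w!))
    λ x → cong (λ v → eval v ⟨$⟩ʳ x) (tabulate-lookup w)

  unique-moves-letters : ∀ {w : Word m} {k} → Unique w → k ∈ w → eval w ⟨$⟩ʳ suc k ≢ suc k
  unique-moves-letters {_ ∷ _} w! k∈w rewrite lookup-index k∈w =
    cycle-moves (unique-isCycle w!) (suc (index k∈w))

  unique-letters-⊆ : ∀ {w₀ w : Word m} → Unique w₀ → eval w₀ ≈ eval w → ∀ {k} → k ∈ w₀ → k ∈ w
  unique-letters-⊆ {w = w} w₀! w₀≈w {k} k∈w₀ = decidable-stable (Any.any? (k ≟_) w) λ k∉w →
    unique-moves-letters w₀! k∈w₀ (trans (w₀≈w (suc k)) (eval-fix-∉ k∉w))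

  unique-eval-injective : ∀ {w w′ : Word m} → Unique w → Unique w′ → eval w ≈ eval w′ → w ≡ w′
  unique-eval-injective {[]}    {[]}      _ _ _ = refl
  unique-eval-injective {[]}    {k ∷ w′}  _ w′! w≈w′ =
    case trans (w≈w′ zero) (eval-fix-∉ (Unique[x∷xs]⇒x∉xs w′!)) of λ ()
  unique-eval-injective {k ∷ w} {[]}      w! _ w≈w′ =
    case trans (sym (w≈w′ zero)) (eval-fix-∉ (Unique[x∷xs]⇒x∉xs w!)) of λ ()
  unique-eval-injective {k ∷ w} {k′ ∷ w′} w!@(_ ∷ w-tail!) w′!@(_ ∷ w′-tail!) w≈w′
    with refl ← suc-injective (trans (sym (eval-fix-∉ (Unique[x∷xs]⇒x∉xs w!)))
                                     (trans (w≈w′ zero) (eval-fix-∉ (Unique[x∷xs]⇒x∉xs w′!))))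
    = cong (k ∷_) (unique-eval-injective w-tail! w′-tail! (eval-∷-cancel {k = k} {w} {w′} w≈w′))

module _ {m : ℕ} {π : Permutation′ (suc m)} where

  unique⇒reduced : ∀ {w} → Unique w → Expresses w π → Reduced w π
  unique⇒reduced w! w↦π = w↦π , λ w′ w′↦π →
    unique-⊆⇒length-≤ w! (unique-letters-⊆ {w = w′} w! λ x → trans (w↦π x) (sym (w′↦π x)))

  unique⇒isCycle : ∀ {w} → Unique w → Expresses w π → IsCycle (length w) π
  unique⇒isCycle w! w↦π = isCycle (cycle-resp-≈ (unique-isCycle w!) {π} w↦π)

  unique⇒moves1 : ∀ {k w} → Unique (k ∷ w) → Expresses (k ∷ w) π → Moves1 π
  unique⇒moves1 kw! kw↦π = cycle-moves (cycle-resp-≈ (unique-isCycle kw!) {π} kw↦π) zero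

  -- Start the cycle at 0; its other points, shifted down by one, spell the word.
  cycle⇒unique : ∀ {t} → IsCycle t π → Moves1 π → ∃ λ w → Unique w × length w ≡ t × Expresses w π
  cycle⇒unique {t} π-cycle π-moves1 with cycleAlong {t = t} {π} π-cycle
  ... | c , cyc with any? (λ i → c i ≟ zero)
  ...   | no zero∉c = contradiction (IsCycleAlong.fix cyc zero λ i ci≡0 → zero∉c (i , ci≡0)) π-moves1
  ...   | yes (i , ci≡0) with c′ , cyc′ , c′0≡ci ← cycle-startingAt cyc i =
    tabulate f , tabulate⁺ f-injective , length-tabulate f ,
    λ x → sym (cycle-unique cyc′ (tabulate-isCycle f-injective) c′≗starCycle x)
    where
    open IsCycleAlong cyc′ using (injective)

    c′0≡0 : c′ zero ≡ zero
    c′0≡0 = trans c′0≡ci ci≡0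

    zero≢c′-suc : ∀ j → zero ≢ c′ (suc j)
    zero≢c′-suc j 0≡c′j = case injective (trans c′0≡0 0≡c′j) of λ ()

    f : Fin t → Fin m
    f j = punchOut (zero≢c′-suc j)

    suc-f : ∀ j → suc (f j) ≡ c′ (suc j)
    suc-f j = punchIn-punchOut (zero≢c′-suc j)

    f-injective : Injective _≡_ _≡_ f
    f-injective {j} {k} fj≡fk = suc-injective (injective (trans (sym (suc-f j)) (trans (cong suc fj≡fk) (suc-f k))))

    c′≗starCycle : ∀ j → c′ j ≡ starCycle f j
    c′≗starCycle zero    = c′0≡0
    c′≗starCycle (suc j) = sym (suc-f j)

-- Fully commutative elements

module _ {m : ℕ} {a x : Fin m} {v : Word m} (a∷x∷v! : Unique (a ∷ x ∷ v)) where
  private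
    R : Permutation′ (suc m)
    R = eval (x ∷ v)

    a≢x : a ≢ x
    a≢x a≡x = Unique[x∷xs]⇒x∉xs a∷x∷v! (here a≡x)

    R-zero : R ⟨$⟩ʳ zero ≡ suc x
    R-zero = eval-fix-∉ (Unique[x∷xs]⇒x∉xs (Unique.tail a∷x∷v!))

    R-suc-a : R ⟨$⟩ʳ suc a ≡ suc a
    R-suc-a = eval-fix-∉ (Unique[x∷xs]⇒x∉xs a∷x∷v!)

  rotate-star : ∀ y → star a ⟨$⟩ʳ (eval (a ∷ x ∷ v) ⟨$⟩ʳ y) ≡ star x ⟨$⟩ʳ (star a ⟨$⟩ʳ (eval (x ∷ v) ⟨$⟩ʳ y))
  rotate-star zero = begin
    star a ⟨$⟩ʳ (R ⟨$⟩ʳ suc a)              ≡⟨ cong (star a ⟨$⟩ʳ_) R-suc-a ⟩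
    star a ⟨$⟩ʳ suc a                       ≡⟨ star-suc-self a ⟩
    zero                                    ≡⟨ star-suc-self x ⟨
    star x ⟨$⟩ʳ suc x                       ≡⟨ cong (star x ⟨$⟩ʳ_) (star-suc-≢ (a≢x ∘ sym)) ⟨
    star x ⟨$⟩ʳ (star a ⟨$⟩ʳ suc x)         ≡⟨ cong (λ z → star x ⟨$⟩ʳ (star a ⟨$⟩ʳ z)) R-zero ⟨
    star x ⟨$⟩ʳ (star a ⟨$⟩ʳ (R ⟨$⟩ʳ zero)) ∎
    where open ≡-Reasoning
  rotate-star (suc j) = by-cases (j ≟ a)
    where
    open ≡-Reasoning
    by-cases : Dec (j ≡ a) →
               star a ⟨$⟩ʳ (R ⟨$⟩ʳ (star a ⟨$⟩ʳ suc j)) ≡ star x ⟨$⟩ʳ (star a ⟨$⟩ʳ (R ⟨$⟩ʳ suc j))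
    by-cases (yes refl) = begin
      star a ⟨$⟩ʳ (R ⟨$⟩ʳ (star a ⟨$⟩ʳ suc a)) ≡⟨ cong (λ z → star a ⟨$⟩ʳ (R ⟨$⟩ʳ z)) (star-suc-self a) ⟩
      star a ⟨$⟩ʳ (R ⟨$⟩ʳ zero)               ≡⟨ cong (star a ⟨$⟩ʳ_) R-zero ⟩
      star a ⟨$⟩ʳ suc x                       ≡⟨ star-suc-≢ (a≢x ∘ sym) ⟩
      star x ⟨$⟩ʳ zero                        ≡⟨ cong (star x ⟨$⟩ʳ_) (star-suc-self a) ⟨
      star x ⟨$⟩ʳ (star a ⟨$⟩ʳ suc a)         ≡⟨ cong (λ z → star x ⟨$⟩ʳ (star a ⟨$⟩ʳ z)) R-suc-a ⟨
      star x ⟨$⟩ʳ (star a ⟨$⟩ʳ (R ⟨$⟩ʳ suc a)) ∎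
    by-cases (no j≢a) = begin
      star a ⟨$⟩ʳ (R ⟨$⟩ʳ (star a ⟨$⟩ʳ suc j)) ≡⟨ cong (λ z → star a ⟨$⟩ʳ (R ⟨$⟩ʳ z)) (star-suc-≢ j≢a) ⟩
      star a ⟨$⟩ʳ (R ⟨$⟩ʳ suc j)               ≡⟨ star-star-fix a≢x Rj≢suc-a Rj≢suc-x ⟨
      star x ⟨$⟩ʳ (star a ⟨$⟩ʳ (R ⟨$⟩ʳ suc j)) ∎
      where
      Rj≢suc-a : R ⟨$⟩ʳ suc j ≢ suc a
      Rj≢suc-a eq = j≢a (suc-injective (permute-injective R (trans eq (sym R-suc-a))))
      Rj≢suc-x : R ⟨$⟩ʳ suc j ≢ suc x
      Rj≢suc-x eq = case permute-injective R {suc j} {zero} (trans eq (sym R-zero)) of λ ()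

  rotation-identity : ∀ s → eval (a ∷ x ∷ v ++ a ∷ s) ≈ eval (x ∷ v ++ a ∷ x ∷ s)
  rotation-identity s y = begin
    eval (a ∷ x ∷ v ++ a ∷ s) ⟨$⟩ʳ y                              ≡⟨ eval-++ (a ∷ x ∷ v) (a ∷ s) y ⟩
    eval s ⟨$⟩ʳ (star a ⟨$⟩ʳ (eval (a ∷ x ∷ v) ⟨$⟩ʳ y))            ≡⟨ cong (eval s ⟨$⟩ʳ_) (rotate-star y) ⟩
    eval s ⟨$⟩ʳ (star x ⟨$⟩ʳ (star a ⟨$⟩ʳ (eval (x ∷ v) ⟨$⟩ʳ y))) ≡⟨ eval-++ (x ∷ v) (a ∷ x ∷ s) y ⟨
    eval (x ∷ v ++ a ∷ x ∷ s) ⟨$⟩ʳ y                              ∎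
    where open ≡-Reasoning

module _ {m : ℕ} {π : Permutation′ (suc m)} where

  fullyCommutative⇒unique : FullyCommutative π → ∀ {w} → Reduced w π → Unique w
  fullyCommutative⇒unique fc {w} w-red with unique⊎repeat _≟_ w
  ... | inj₁ w! = w!
  ... | inj₂ (repeat p a [] s _) = contradiction (s≤s (n≤1+n (length s)))
    (reduced-no-shorter-replacement {π = π} p (a ∷ a ∷ s) s (λ y → cong (eval s ⟨$⟩ʳ_) (star-involutive a y)) w-red)
  ... | inj₂ (repeat p a (x ∷ v) s a∷x∷v!@((a≢x ∷ _) ∷ _)) =
    contradiction (∷-injectiveˡ (++-cancelˡ p _ _ (commEquiv⇒≡ (fc _ _ w-red rotated-red)))) a≢x
    where
    same-length : length (a ∷ x ∷ v ++ a ∷ s) ≡ length (x ∷ v ++ a ∷ x ∷ s)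
    same-length = cong suc (trans (cong suc (length-++ v))
      (trans (sym (+-suc (length v) (suc (length s)))) (sym (length-++ v))))

    rotated-red : Reduced (p ++ x ∷ v ++ a ∷ x ∷ s) π
    rotated-red = reduced-replace {π = π} p _ _ (rotation-identity a∷x∷v! s) w-red same-length

  reduced-unique : ∀ {w₀} → Unique w₀ → Expresses w₀ π → ∀ {w} → Reduced w π → Unique w
  reduced-unique {w₀} w₀! w₀↦π {w} (w↦π , minimal) with unique⊎repeat _≟_ w
  ... | inj₁ w! = w!
  ... | inj₂ (repeat p a v s _) = contradiction (minimal w₀ w₀↦π) (<⇒≱ (≤-<-trans w₀-bound dropped-shorter))
    where
    reassociate : (p ++ a ∷ v) ++ a ∷ s ≡ p ++ a ∷ v ++ a ∷ s
    reassociate = ++-assoc p (a ∷ v) (a ∷ s)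

    w₀-bound : length w₀ ≤ length ((p ++ a ∷ v) ++ s)
    w₀-bound = unique-⊆⇒length-≤ w₀! λ k∈w₀ →
      drop-later-copy (p ++ a ∷ v) (∈-++⁺ʳ p (here refl))
        (subst (_ ∈_) (sym reassociate) (unique-letters-⊆ w₀! (λ y → trans (w₀↦π y) (sym (w↦π y))) k∈w₀))

    dropped-shorter : length ((p ++ a ∷ v) ++ s) < length (p ++ a ∷ v ++ a ∷ s)
    dropped-shorter = subst (length ((p ++ a ∷ v) ++ s) <_) (cong length reassociate)
      (++-length-<ʳ (p ++ a ∷ v) {s} (n<1+n (length s)))

  unique⇒fullyCommutative : ∀ {w₀} → Unique w₀ → Expresses w₀ π → FullyCommutative π
  unique⇒fullyCommutative w₀! w₀↦π w w′ w-red w′-red =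
    subst (CommEquiv w) (unique-eval-injective {w = w} {w′} (reduced-unique w₀! w₀↦π w-red)
      (reduced-unique w₀! w₀↦π w′-red) λ y → trans (proj₁ w-red y) (sym (proj₁ w′-red y))) ε

-- Existence of reduced words

least-witness : ∀ {P : ℕ → Set} → (∀ n → Dec (P n)) → ∀ {N} → P N → ∃ λ n → P n × (∀ k → P k → n ≤ k)
least-witness P? {N} pN with P? zero
... | yes p0 = zero , p0 , λ _ _ → z≤n
least-witness P? {zero}  pN | no ¬p0 = contradiction pN ¬p0
least-witness P? {suc N} pN | no ¬p0 with least-witness (P? ∘ suc) pN
... | n , pn , least = suc n , pn , λ where
  zero    p0 → contradiction p0 ¬p0
  (suc k) pk → s≤s (least k pk)

transpositionWord : ∀ {m} → Fin (suc m) → Fin (suc m) → Word m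
transpositionWord zero    zero    = []
transpositionWord zero    (suc b) = b ∷ []
transpositionWord (suc a) zero    = a ∷ []
transpositionWord (suc a) (suc b) with a ≟ b
... | yes _ = []
... | no _  = a ∷ b ∷ a ∷ []

transpositionWord-correct : ∀ {m} (i j : Fin (suc m)) → transpose i j ≈ eval (transpositionWord i j)
transpositionWord-correct zero    zero    = transpose-refl zero
transpositionWord-correct zero    (suc b) _ = refl
transpositionWord-correct (suc a) zero    =
  transpose-≈ (eval (a ∷ [])) (star-suc-self a) refl λ k≢suc-a k≢zero → star-fix k≢zero k≢suc-a
transpositionWord-correct (suc a) (suc b) with a ≟ b
... | yes refl = transpose-refl (suc a)
... | no a≢b   = transpose-≈ (eval (a ∷ b ∷ a ∷ [])) suc-a↦suc-b suc-b↦suc-a fixes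
  where
  open ≡-Reasoning

  suc-a↦suc-b : star a ⟨$⟩ʳ (star b ⟨$⟩ʳ (star a ⟨$⟩ʳ suc a)) ≡ suc b
  suc-a↦suc-b = begin
    star a ⟨$⟩ʳ (star b ⟨$⟩ʳ (star a ⟨$⟩ʳ suc a)) ≡⟨ cong (λ z → star a ⟨$⟩ʳ (star b ⟨$⟩ʳ z)) (star-suc-self a) ⟩
    star a ⟨$⟩ʳ suc b                            ≡⟨ star-suc-≢ (a≢b ∘ sym) ⟩
    suc b                                        ∎

  suc-b↦suc-a : star a ⟨$⟩ʳ (star b ⟨$⟩ʳ (star a ⟨$⟩ʳ suc b)) ≡ suc a
  suc-b↦suc-a = begin
    star a ⟨$⟩ʳ (star b ⟨$⟩ʳ (star a ⟨$⟩ʳ suc b)) ≡⟨ cong (λ z → star a ⟨$⟩ʳ (star b ⟨$⟩ʳ z)) (star-suc-≢ (a≢b ∘ sym)) ⟩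
    star a ⟨$⟩ʳ (star b ⟨$⟩ʳ suc b)              ≡⟨ cong (star a ⟨$⟩ʳ_) (star-suc-self b) ⟩
    suc a                                        ∎

  fixes : ∀ {k} → k ≢ suc a → k ≢ suc b → star a ⟨$⟩ʳ (star b ⟨$⟩ʳ (star a ⟨$⟩ʳ k)) ≡ k
  fixes {zero} _ _ = begin
    star a ⟨$⟩ʳ (star b ⟨$⟩ʳ suc a) ≡⟨ cong (star a ⟨$⟩ʳ_) (star-suc-≢ a≢b) ⟩
    star a ⟨$⟩ʳ suc a               ≡⟨ star-suc-self a ⟩
    zero                            ∎
  fixes {suc j} k≢suc-a k≢suc-b = begin
    star a ⟨$⟩ʳ (star b ⟨$⟩ʳ (star a ⟨$⟩ʳ suc j)) ≡⟨ cong (λ z → star a ⟨$⟩ʳ (star b ⟨$⟩ʳ z)) (star-fix (λ ()) k≢suc-a) ⟩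
    star a ⟨$⟩ʳ (star b ⟨$⟩ʳ suc j)              ≡⟨ cong (star a ⟨$⟩ʳ_) (star-fix (λ ()) k≢suc-b) ⟩
    star a ⟨$⟩ʳ suc j                            ≡⟨ star-fix (λ ()) k≢suc-a ⟩
    suc j                                        ∎

transpositionsWord : ∀ {m} → TranspositionList (suc m) → Word m
transpositionsWord []             = []
transpositionsWord ((i , j) ∷ τs) = transpositionWord i j ++ transpositionsWord τs

transpositionsWord-correct : ∀ {m} (τs : TranspositionList (suc m)) → TL.eval τs ≈ eval (transpositionsWord τs)
transpositionsWord-correct []             x = refl
transpositionsWord-correct ((i , j) ∷ τs) x = begin
  TL.eval τs ⟨$⟩ʳ (transpose i j ⟨$⟩ʳ x)                                ≡⟨ transpositionsWord-correct τs _ ⟩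
  eval (transpositionsWord τs) ⟨$⟩ʳ (transpose i j ⟨$⟩ʳ x)               ≡⟨ cong (eval (transpositionsWord τs) ⟨$⟩ʳ_)
                                                                                 (transpositionWord-correct i j x) ⟩
  eval (transpositionsWord τs) ⟨$⟩ʳ (eval (transpositionWord i j) ⟨$⟩ʳ x) ≡⟨ eval-++ (transpositionWord i j) _ x ⟨
  eval (transpositionWord i j ++ transpositionsWord τs) ⟨$⟩ʳ x           ∎
  where open ≡-Reasoning

expressible : ∀ {m} (π : Permutation′ (suc m)) → ∃ λ w → Expresses w π
expressible π = transpositionsWord (TL.decompose π) ,
  λ x → trans (sym (transpositionsWord-correct (TL.decompose π) x)) (TL.eval-decompose π x)

ExpressibleWithLength : ∀ {m} → Permutation′ (suc m) → ℕ → Set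
ExpressibleWithLength {m} π ℓ = ∃ λ (w : Word m) → length w ≡ ℓ × Expresses w π

expresses-∷⁺ : ∀ {m} {k : Fin m} {w π} → Expresses w (star k ∘ₚ π) → Expresses (k ∷ w) π
expresses-∷⁺ {k = k} {π = π} w↦kπ x = trans (w↦kπ (star k ⟨$⟩ʳ x)) (cong (π ⟨$⟩ʳ_) (star-involutive k x))

expresses-∷⁻ : ∀ {m} {k : Fin m} {w π} → Expresses (k ∷ w) π → Expresses w (star k ∘ₚ π)
expresses-∷⁻ {k = k} {w} kw↦π x = trans (cong (eval w ⟨$⟩ʳ_) (sym (star-involutive k x))) (kw↦π (star k ⟨$⟩ʳ x))

expressibleWithLength? : ∀ {m} (π : Permutation′ (suc m)) ℓ → Dec (ExpressibleWithLength π ℓ)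
expressibleWithLength? π zero with all? (λ x → x ≟ π ⟨$⟩ʳ x)
... | yes id≈π = yes ([] , refl , id≈π)
... | no id≉π  = no λ where ([] , refl , id≈π) → id≉π id≈π
expressibleWithLength? π (suc ℓ) with any? (λ k → expressibleWithLength? (star k ∘ₚ π) ℓ)
... | yes (k , w , refl , w↦kπ) = yes (k ∷ w , refl , expresses-∷⁺ {w = w} {π} w↦kπ)
... | no ¬shorter = no λ where
  (k ∷ w , refl , kw↦π) → ¬shorter (k , w , refl , expresses-∷⁻ {w = w} {π} kw↦π)

-- Opaque, as unfolding this search during unification makes type checking blow up.
opaque
  reduced-exists : ∀ {m} (π : Permutation′ (suc m)) → ∃ λ w → Reduced w π
  reduced-exists π with w₀ , w₀↦π ← expressible π
    with _ , (w , refl , w↦π) , least ← least-witness (expressibleWithLength? π) (w₀ , refl , w₀↦π)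
    = w , w↦π , λ w′ w′↦π → least (length w′) (w′ , refl , w′↦π)

-- Counting

sum-map-*ˡ : ∀ c (xs : List ℕ) → sum (map (c *_) xs) ≡ c * sum xs
sum-map-*ˡ c []       = sym (*-zeroʳ c)
sum-map-*ˡ c (x ∷ xs) = trans (cong (c * x +_) (sum-map-*ˡ c xs)) (sym (*-distribˡ-+ c x (sum xs)))

from1-suc : ∀ t → from1 (suc t) ≡ 1 ∷ map suc (from1 t)
from1-suc t = cong (λ l → 1 ∷ map suc l) (sym (map-upTo suc t))

arrangements : ℕ → ℕ → ℕ
arrangements n t = product (map (λ j → n ∸ j) (from1 t))

arrangements-suc : ∀ n t → arrangements (suc n) (suc t) ≡ n * arrangements n t
arrangements-suc n t = begin
  arrangements (suc n) (suc t)                     ≡⟨ cong (product ∘ map (suc n ∸_)) (from1-suc t) ⟩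
  n * product (map (suc n ∸_) (map suc (from1 t))) ≡⟨ cong ((n *_) ∘ product) (map-∘ (from1 t)) ⟨
  n * arrangements n t                             ∎
  where open ≡-Reasoning

fcCount-suc : ∀ m → fcCount (suc (suc m)) ≡ suc (suc m * fcCount (suc m))
fcCount-suc m = cong suc (begin
  sum (map A (from1 (suc m)))                                         ≡⟨ cong (sum ∘ map A) (from1-suc m) ⟩
  A 1 + sum (map A (map suc (from1 m)))                               ≡⟨ cong ((A 1 +_) ∘ sum) (map-∘ (from1 m)) ⟨
  A 1 + sum (map (A ∘ suc) (from1 m))                                 ≡⟨ cong ((A 1 +_) ∘ sum)
                                                                           (map-cong (arrangements-suc (suc m)) (from1 m)) ⟩
  suc m * 1 + sum (map ((suc m *_) ∘ arrangements (suc m)) (from1 m)) ≡⟨ cong ((suc m * 1 +_) ∘ sum) (map-∘ (from1 m)) ⟩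
  suc m * 1 + sum (map (suc m *_) (map (arrangements (suc m)) (from1 m)))
                                                                      ≡⟨ cong (suc m * 1 +_) (sum-map-*ˡ (suc m) (map (arrangements (suc m)) (from1 m))) ⟩
  suc m * 1 + suc m * S                                               ≡⟨ *-distribˡ-+ (suc m) 1 S ⟨
  suc m * suc S                                                       ∎)
  where
  open ≡-Reasoning
  A = arrangements (suc (suc m))
  S = sum (map (arrangements (suc m)) (from1 m))

prependLetter : ∀ {m} → Fin (suc m) → Word m → Word (suc m)
prependLetter k w = k ∷ map (punchIn k) w

uniqueWords : ∀ m → List (Word m)
uniqueWords zero    = [] ∷ []
uniqueWords (suc m) = [] ∷ cartesianProductWith prependLetter (allFin (suc m)) (uniqueWords m)

length-uniqueWords : ∀ m → length (uniqueWords m) ≡ fcCount (suc m)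
length-uniqueWords zero    = refl
length-uniqueWords (suc m) = begin
  suc (length (cartesianProductWith prependLetter (allFin (suc m)) (uniqueWords m)))
    ≡⟨ cong suc (length-cartesianProductWith prependLetter (allFin (suc m)) (uniqueWords m)) ⟩
  suc (length (allFin (suc m)) * length (uniqueWords m))
    ≡⟨ cong suc (cong₂ _*_ (length-tabulate {n = suc m} id) (length-uniqueWords m)) ⟩
  suc (suc m * fcCount (suc m))
    ≡⟨ fcCount-suc m ⟨
  fcCount (suc (suc m))
    ∎
  where open ≡-Reasoning

punchOutAll : ∀ {m} {k : Fin (suc m)} (w : Word (suc m)) → All (k ≢_) w → Word m
punchOutAll []      []          = []
punchOutAll (j ∷ w) (k≢j ∷ k∉w) = punchOut k≢j ∷ punchOutAll w k∉w

map-punchIn-punchOutAll : ∀ {m} {k : Fin (suc m)} (w : Word (suc m)) (k∉w : All (k ≢_) w) →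
                          map (punchIn k) (punchOutAll w k∉w) ≡ w
map-punchIn-punchOutAll []      []          = refl
map-punchIn-punchOutAll (j ∷ w) (k≢j ∷ k∉w) = cong₂ _∷_ (punchIn-punchOut k≢j) (map-punchIn-punchOutAll w k∉w)

prependLetter-unique : ∀ {m} (k : Fin (suc m)) {w} → Unique w → Unique (prependLetter k w)
prependLetter-unique k w! =
  All.map⁺ (All.universal (λ x → punchInᵢ≢i k x ∘ sym) _) ∷ Unique.map⁺ (punchIn-injective k _ _) w!

prependLetter-injective : ∀ {m} {k k′ : Fin (suc m)} {w w′} →
                          prependLetter k w ≡ prependLetter k′ w′ → k ≡ k′ × w ≡ w′
prependLetter-injective {k = k} eq with refl ← ∷-injectiveˡ eq =
  refl , map-injective (punchIn-injective k _ _) (∷-injectiveʳ eq)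

uniqueWords-sound : ∀ m {w} → w ∈ uniqueWords m → Unique w
uniqueWords-sound zero    (here refl) = []
uniqueWords-sound (suc m) (here refl) = []
uniqueWords-sound (suc m) (there w∈)
  with k , w′ , _ , w′∈ , refl ← ∈-cartesianProductWith⁻ prependLetter (allFin (suc m)) (uniqueWords m) w∈
  = prependLetter-unique k (uniqueWords-sound m w′∈)

uniqueWords-complete : ∀ m {w} → Unique w → w ∈ uniqueWords m
uniqueWords-complete zero    {[]}    _          = here refl
uniqueWords-complete (suc m) {[]}    _          = here refl
uniqueWords-complete (suc m) {k ∷ w} (k∉w ∷ w!) =
  there (subst (_∈ cartesianProductWith prependLetter (allFin (suc m)) (uniqueWords m))
               (cong (k ∷_) (map-punchIn-punchOutAll w k∉w))
               (∈-cartesianProductWith⁺ prependLetter (∈-allFin k) (uniqueWords-complete m punchedOut!)))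
  where
  punchedOut! : Unique (punchOutAll w k∉w)
  punchedOut! = Unique.map⁻ (subst Unique (sym (map-punchIn-punchOutAll w k∉w)) w!)

uniqueWords-distinct : ∀ m → Unique (uniqueWords m)
uniqueWords-distinct zero    = [] ∷ []
uniqueWords-distinct (suc m) =
  All.tabulate []∉ ∷ Unique.cartesianProductWith⁺ prependLetter prependLetter-injective
                       (allFin⁺ (suc m)) (uniqueWords-distinct m)
  where
  []∉ : ∀ {w} → w ∈ cartesianProductWith prependLetter (allFin (suc m)) (uniqueWords m) → [] ≢ w
  []∉ w∈ with _ , _ , _ , _ , refl ← ∈-cartesianProductWith⁻ prependLetter (allFin (suc m)) (uniqueWords m) w∈ = λ ()

countFC : ∀ m → CountFC m (fcCount (suc m))
countFC m = map eval (uniqueWords m) , all-fullyCommutative , complete , distinct ,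
            trans (length-map eval (uniqueWords m)) (length-uniqueWords m)
  where
  all-fullyCommutative : All FullyCommutative (map eval (uniqueWords m))
  all-fullyCommutative = All.map⁺ (All.tabulate λ {w} w∈ →
    unique⇒fullyCommutative {π = eval w} (uniqueWords-sound m w∈) λ _ → refl)

  complete : ∀ π → FullyCommutative π → Any (_≈ π) (map eval (uniqueWords m))
  complete π fc with w , w-red ← reduced-exists π = Any.map⁺ (Any.map {P = w ≡_} (λ { refl → proj₁ w-red })
    (uniqueWords-complete m {w} (fullyCommutative⇒unique {π = π} fc {w} w-red)))

  distinct : AllPairs (λ ρ σ → ¬ ρ ≈ σ) (map eval (uniqueWords m))
  distinct = AllPairs.map⁺ (AllPairs-map-All (λ u! v! u≢v u≈v → u≢v (unique-eval-injective u! v! u≈v))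
    (All.tabulate (uniqueWords-sound m)) (uniqueWords-distinct m))

fullyCommutative⇔cycle : ∀ {m} {π : Permutation′ (suc m)} {t} → 0 < t →
                         (FullyCommutative π × HasLength π t) ⇔ (IsCycle t π × Moves1 π)
fullyCommutative⇔cycle {π = π} 0<t = mk⇔ (to 0<t) from
  where
  to : ∀ {t} → 0 < t → FullyCommutative π × HasLength π t → IsCycle t π × Moves1 π
  to _ (fc , k ∷ w , kw-red , refl) =
    unique⇒isCycle {π = π} {k ∷ w} kw! (proj₁ kw-red) , unique⇒moves1 {π = π} {k} {w} kw! (proj₁ kw-red)
    where kw! = fullyCommutative⇒unique {π = π} fc {k ∷ w} kw-red

  from : ∀ {t} → IsCycle t π × Moves1 π → FullyCommutative π × HasLength π t
  from (π-cycle , π-moves1) with w , w! , refl , w↦π ← cycle⇒unique {π = π} π-cycle π-moves1 =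
    unique⇒fullyCommutative {π = π} w! w↦π , w , unique⇒reduced {π = π} w! w↦π , refl

proposition4p7 : ∀ (m : ℕ) → 1 ≤ m →
    CountFC m (fcCount (suc m))
    × (∀ (t : ℕ) → 0 < t → ∀ (π : Permutation′ (suc m)) →
        (FullyCommutative π × HasLength π t) ⇔ (IsCycle t π × Moves1 π))
proposition4p7 m _ = countFC m , λ t 0<t π → fullyCommutative⇔cycle {π = π} 0<t
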